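{- For every $\pi\in G_{r,n}$ and all integers $j,k\ge0$, \[ \sum_{I\subseteq[n]}\Omega_{Z(I,\pi)}(j,k)=\sum_{I\subseteq[n]}\Omega_{C(I,\pi)}(j,k). \]
   Context: Fix integers $r\ge1$, $n\ge1$, $[n]=\{1,\dots,n\}$, $[0,n]=\{0,\dots,n\}$. For a totally ordered set $Y$, $Y_{(r)}=\{0,\dots,r-1\}\times Y$ ordered lexicographically; write $x_k$ for $(k,x)$, $Y_k=\{k\}\times Y$, $|x_k|=x$, $\epsilon(x_k)=k$; colors read mod $r$. $G_{r,n}$ is the group of bijections $\pi$ of $[n]_{(r)}$ with $\pi(i_j)=k_l\Rightarrow\pi(i_{j+a})=k_{l+a}$ (mod $r$); one-line notation $\pi(1)\cdots\pi(n)$, $\pi(i)=\pi(i_0)$. An $r$-colored poset is a set $P=\{0_1,\dots,0_{r-1}\}\cup Q$, $Q\subseteq[n]_{(r)}$ with distinct absolute values, with a partial order $\prec$ such that $0_1\prec\cdots\prec0_{r-1}$. With $X=[0,j]$, a colored $P$-partition is a map $f:P\to X_{(r)}$ with (i) $f(0_k)=(k,0)$; (ii) $a\prec b\Rightarrow f(a)\le f(b)$; (iii) if $a\prec b$, $f(a),f(b)\in X_k$ for the same $k$, and $|a|_{\epsilon(a)-k}>|b|_{\epsilon(b)-k}$ in $[0,n]_{(r)}$, then $f(a)<f(b)$; (iv) if $f(a)=(k,j)$ then $\epsilon(a)=k$. $\Omega_P(j)$ is the number of such $f$. For $I\subseteq[n]$ and $\pi\in G_{r,n}$ (with $\pi(n+1)=0_1$):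 $Z(I,\pi)$ is the colored poset on $\{\pi(1),\dots,\pi(n),0_1,\dots,0_{r-1}\}$ with order generated by $0_1\prec\cdots\prec0_{r-1}$ and, for $i\in[n]$, $\pi(i)\prec\pi(i+1)$ if $i\notin I$, $\pi(i)\succ\pi(i+1)$ if $i\in I$. $C(I,\pi)$ is the colored poset on the same set with order generated by $0_1\prec\cdots\prec0_{r-1}$ and $\pi(i)\prec\pi(i+1)$ for $i\in[n]\setminus I$. Bars may be placed in the $n+1$ spaces numbered $0,\dots,n$ in the sequence $\pi(1),\dots,\pi(n),0_1$: space $0$ is left of $\pi(1)$ and space $i\ge1$ is between $\pi(i)$ and $\pi(i+1)$. A barred $Z(I,\pi)$ poset with $k$ bars is a choice of multiplicities $(b_0,\dots,b_n)$ of nonnegative integers with $\sum b_i=k$ and $b_i\ge1$ for all $i\in I$. A barred $C(I,\pi)$ poset with $k$ bars is such a choice with $\sum b_i=k$, $b_i\ge1$ for $i\in I$, and $b_i=0$ for $i\in[n]\setminus I$ ($b_0$ arbitrary). $\Omega_{Z(I,\pi)}(j,k)$ is the number of pairs $(f,B)$ with $B$ a barred $Z(I,\pi)$ poset with $k$ bars and $f$ a colored $Z(I,\pi)$-partition with values in $[0,j]_{(r)}$; $\Omega_{C(I,\pi)}(j,k)$ is defined analogously with $C(I,\pi)$. -}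

module Defs where

open import Data.Nat using (ℕ; zero; suc; _+_; _∸_; _≡ᵇ_; _<ᵇ_)
open import Data.Nat.DivMod using (_mod_)
open import Data.Fin using (Fin; toℕ) renaming (zero to fzero; suc to fsuc)
open import Data.Bool using (Bool; true; false; _∧_; _∨_; not; if_then_else_)
open import Data.Product using (_×_; _,_; proj₁; proj₂)
open import Data.Sum using (_⊎_; inj₁; inj₂)
open import Data.Vec using (Vec; []; _∷_; lookup)
open import Data.List using (List; []; _∷_; map; _++_; allFin; upTo; filterᵇ;
  length; cartesianProduct; concatMap)
open import Data.Bool.ListAction using (all; any)
open import Data.Nat.ListAction using (sum)
open import Relation.Binary.PropositionalEquality using (_≡_)
open import Function.Definitions using (Bijective)

-- Colours: Fin r, arithmetic mod r (r ≥ 1; for r = 0 Fin r is empty).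

_⊕_ : ∀ {r} → Fin r → Fin r → Fin r
_⊕_ {suc r} a b = (toℕ a + toℕ b) mod suc r

_⊖_ : ∀ {r} → Fin r → Fin r → Fin r
_⊖_ {suc r} a b = (toℕ a + (suc r ∸ toℕ b)) mod suc r

-- Y_(r) = {0..r-1} × Y.  [n]_(r) is represented by Fin r × Fin n,
-- where (k , x) stands for x_k with x ∈ [n] corresponding to toℕ x + 1.

record G (r n : ℕ) : Set where
  field
    fun : Fin r × Fin n → Fin r × Fin n
    bij : Bijective _≡_ _≡_ fun
    equivariant : ∀ (i : Fin n) (j : Fin r) (k : Fin n) (l : Fin r) (a : Fin r) →
      fun (j , i) ≡ (l , k) → fun (j ⊕ a , i) ≡ (l ⊕ a , k)
open G public

_==_ : ℕ → ℕ → Bool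
m == n = m ≡ᵇ n

_<<_ : ℕ → ℕ → Bool
m << n = m <ᵇ n

lexLt : ∀ {r m} → Fin r × Fin m → Fin r × Fin m → Bool
lexLt (a , x) (b , y) = (toℕ a << toℕ b) ∨ ((toℕ a == toℕ b) ∧ (toℕ x << toℕ y))

lexEq : ∀ {r m} → Fin r × Fin m → Fin r × Fin m → Bool
lexEq (a , x) (b , y) = (toℕ a == toℕ b) ∧ (toℕ x == toℕ y)

lexLe : ∀ {r m} → Fin r × Fin m → Fin r × Fin m → Bool
lexLe p q = lexLt p q ∨ lexEq p q

allVecs : ∀ {A : Set} → List A → (m : ℕ) → List (Vec A m)
allVecs xs zero = [] ∷ []
allVecs xs (suc m) = concatMap (λ x → map (x ∷_) (allVecs xs m)) xs

count : ∀ {A : Set} → (A → Bool) → List A → ℕ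
count p xs = length (filterᵇ p xs)

-- all subsets I ⊆ [n], as characteristic vectors (entry i ↔ element toℕ i + 1)
Subset : ℕ → Set
Subset n = Vec Bool n

allSubsets : (n : ℕ) → List (Subset n)
allSubsets n = allVecs (false ∷ true ∷ []) n

-- Number of elements 0_1, …, 0_{r-1}.  Colours are read mod r, so for
-- r = 1 the element π(n+1) = 0_1 = 0_0 is the single zero element
--; for r ≥ 2 these are 0_1,…,0_{r-1}.
nZeros : ℕ → ℕ
nZeros zero = zero
nZeros (suc zero) = suc zero
nZeros (suc (suc r)) = suc r

-- The underlying set {π(1),…,π(n), 0_1,…,0_{r-1}} of Z(I,π) and C(I,π).
-- inj₁ i  is  π(toℕ i + 1);   inj₂ m  is  0_{toℕ m + 1}.

Elt : ℕ → ℕ → Set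
Elt r n = Fin n ⊎ Fin (nZeros r)

allElts : (r n : ℕ) → List (Elt r n)
allElts r n = map inj₁ (allFin n) ++ map inj₂ (allFin (nZeros r))

-- From here on the number of colours is written  suc r  (r ≥ 1 colours);
-- 0_{toℕ m + 1} has colour  (toℕ m + 1) mod (suc r).
zeroColour : ∀ {r} → Fin (nZeros (suc r)) → Fin (suc r)
zeroColour {r} m = suc (toℕ m) mod suc r

-- π(i) = π(i_0)
πat : ∀ {r n} → G (suc r) n → Fin n → Fin (suc r) × Fin n
πat π i = fun π (fzero , i)

-- each element as an element of [0,n]_(r): (colour ε(a), absolute value |a|)
label : ∀ {r n} → G (suc r) n → Elt (suc r) n → Fin (suc r) × Fin (suc n)
label π (inj₁ i) = proj₁ (πat π i) , fsuc (proj₂ (πat π i))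
label π (inj₂ m) = zeroColour m , fzero

-- Generating relations (a "gen" b means a ≺ b is one of the generators).
-- Positions: π(i) for i ∈ [n], and π(n+1) = 0_1.

isZeroIdx : ∀ {k} → Fin k → Bool
isZeroIdx m = toℕ m == 0

isLast : ∀ {n} → Fin n → Bool
isLast {n} i = suc (toℕ i) == n

genZeros : ∀ {k} → Fin k → Fin k → Bool
genZeros m m' = toℕ m' == suc (toℕ m)

-- Z(I,π): π(i) ≺ π(i+1) if i ∉ I, π(i) ≻ π(i+1) if i ∈ I  (i ∈ [n])
genZ : ∀ {r n} → Subset n → Elt r n → Elt r n → Bool
genZ I (inj₁ i) (inj₁ i') =
  ((toℕ i' == suc (toℕ i)) ∧ not (lookup I i)) ∨ ((toℕ i == suc (toℕ i')) ∧ lookup I i')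
genZ I (inj₁ i) (inj₂ m) = isZeroIdx m ∧ isLast i ∧ not (lookup I i)
genZ I (inj₂ m) (inj₁ i) = isZeroIdx m ∧ isLast i ∧ lookup I i
genZ I (inj₂ m) (inj₂ m') = genZeros m m'

-- C(I,π): π(i) ≺ π(i+1) for i ∈ [n] ∖ I
genC : ∀ {r n} → Subset n → Elt r n → Elt r n → Bool
genC I (inj₁ i) (inj₁ i') = (toℕ i' == suc (toℕ i)) ∧ not (lookup I i)
genC I (inj₁ i) (inj₂ m) = isZeroIdx m ∧ isLast i ∧ not (lookup I i)
genC I (inj₂ m) (inj₁ i) = false
genC I (inj₂ m) (inj₂ m') = genZeros m m'

-- The order generated by a relation: its transitive closure, i.e.
-- a ≺ b iff there is a chain a = c₀ gen c₁ gen ⋯ gen c_t = b with t ≥ 1.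
-- On a finite set with s elements chains of length ≤ s suffice.
reach : ∀ {A : Set} → List A → (A → A → Bool) → ℕ → A → A → Bool
reach els R zero a b = R a b
reach els R (suc t) a b = reach els R t a b ∨ any (λ c → reach els R t a c ∧ R c b) els

order : ∀ {r n} → (Elt r n → Elt r n → Bool) → Elt r n → Elt r n → Bool
order {r} {n} R = reach (allElts r n) R (n + nZeros r)

Val : ℕ → ℕ → Set
Val r j = Fin r × Fin (suc j)

-- a map f : P → X_(r), stored as its values on π(1..n) and on 0_1..0_{r-1}
Map : ℕ → ℕ → ℕ → Set
Map r n j = Vec (Val r j) n × Vec (Val r j) (nZeros r)

app : ∀ {r n j} → Map r n j → Elt r n → Val r j
app f (inj₁ i) = lookup (proj₁ f) i
app f (inj₂ m) = lookup (proj₂ f) m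

allVals : (r j : ℕ) → List (Val r j)
allVals r j = cartesianProduct (allFin r) (allFin (suc j))

allMaps : (r n j : ℕ) → List (Map r n j)
allMaps r n j = cartesianProduct (allVecs (allVals r j) n) (allVecs (allVals r j) (nZeros r))

isPPartition : ∀ {r n} → G (suc r) n → (Elt (suc r) n → Elt (suc r) n → Bool) →
               (j : ℕ) → Map (suc r) n j → Bool
isPPartition {r} {n} π lt j f =
     all cond1 (allFin (nZeros (suc r)))
   ∧ all (λ a → all (λ b → not (lt a b) ∨ (cond2 a b ∧ cond3 a b)) els) els
   ∧ all cond4 els
  where
  els = allElts (suc r) n
  cond1 : Fin (nZeros (suc r)) → Bool
  cond1 m = lexEq (app f (inj₂ m)) (zeroColour m , fzero)
  cond2 : Elt (suc r) n → Elt (suc r) n → Bool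
  cond2 a b = lexLe (app f a) (app f b)
  -- (iii) a ≺ b, f(a), f(b) ∈ X_k, |a|_{ε(a)-k} > |b|_{ε(b)-k} ⇒ f(a) < f(b)
  cond3 : Elt (suc r) n → Elt (suc r) n → Bool
  cond3 a b =
    let k  = proj₁ (app f a)
        la = label π a
        lb = label π b
    in not ((toℕ (proj₁ (app f a)) == toℕ (proj₁ (app f b)))
            ∧ lexLt (proj₁ lb ⊖ k , proj₂ lb) (proj₁ la ⊖ k , proj₂ la))
       ∨ lexLt (app f a) (app f b)
  cond4 : Elt (suc r) n → Bool
  cond4 a = not (toℕ (proj₂ (app f a)) == j)
            ∨ (toℕ (proj₁ (app f a)) == toℕ (proj₁ (label π a)))

-- Bars: multiplicities (b_0,…,b_n) in the spaces 0,…,n; entry `fsuc i`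
-- of the vector is the space between π(toℕ i + 1) and its successor.

Bars : ℕ → Set
Bars n = Vec ℕ (suc n)

vsum : ∀ {m} → Vec ℕ m → ℕ
vsum [] = 0
vsum (x ∷ v) = x + vsum v

allBars : (n k : ℕ) → List (Bars n)
allBars n k = filterᵇ (λ b → vsum b == k) (allVecs (upTo (suc k)) (suc n))

isBarredZ : ∀ {n} → Subset n → Bars n → Bool
isBarredZ {n} I b = all (λ i → not (lookup I i) ∨ (0 << lookup b (fsuc i))) (allFin n)

isBarredC : ∀ {n} → Subset n → Bars n → Bool
isBarredC {n} I b = all (λ i → if lookup I i then 0 << lookup b (fsuc i)
                                              else lookup b (fsuc i) == 0) (allFin n)

-- (for r = 0 there are no colours; the value 0 is a dummy, the theorem assumes r ≥ 1)
ΩZ : ∀ {r n} → G r n → Subset n → ℕ → ℕ → ℕ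
ΩZ {zero} π I j k = 0
ΩZ {suc r} {n} π I j k =
  count (λ (fB : Map (suc r) n j × Bars n) →
           isPPartition π (order {suc r} {n} (genZ {suc r} I)) j (proj₁ fB) ∧ isBarredZ I (proj₂ fB))
        (cartesianProduct (allMaps (suc r) n j) (allBars n k))

ΩC : ∀ {r n} → G r n → Subset n → ℕ → ℕ → ℕ
ΩC {zero} π I j k = 0
ΩC {suc r} {n} π I j k =
  count (λ (fB : Map (suc r) n j × Bars n) →
           isPPartition π (order {suc r} {n} (genC {suc r} I)) j (proj₁ fB) ∧ isBarredC I (proj₂ fB))
        (cartesianProduct (allMaps (suc r) n j) (allBars n k))

ΣSubsets : (n : ℕ) → (Subset n → ℕ) → ℕ
ΣSubsets n F = sum (map F (allSubsets n))

module Submission where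

-- For a fixed pair (f , B), conditions (ii) and (iii) on a ≺ b say exactly that key a ≤ key b, where
-- key a = (f a , |a| recoloured by the colour of f a) is compared lexicographically.  This relation is
-- transitive, so f is a P-partition of a poset as soon as it respects the generating relations; and it
-- is total and antisymmetric between π(i) and π(i+1), whose absolute values differ.  Hence f is a
-- Z(I,π)-partition for exactly one I, its set of descents, while B is a barred C(I,π) poset for exactly
-- one I, its set of occupied spaces.  Then (f , B) is counted on the left iff every descent carries a
-- bar, and on the right iff every space without a bar is an ascent: the same condition.

open import Defs
open import Data.Bool using (Bool; true; false; _∧_; _∨_; not; T; if_then_else_)
open import Data.Bool.ListAction using (all)
open import Data.Bool.Properties using (T-∧; T-∨; T-≡; T-not-≡; not-injective)
open import Data.Fin as Fin using (Fin; toℕ) renaming (zero to fzero; suc to fsuc)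
open import Data.Fin.Properties using (toℕ-injective; suc-injective; toℕ-fromℕ<; toℕ<n; <-strictTotalOrder)
open import Data.List using (List; []; _∷_; map; _++_; allFin; cartesianProduct)
open import Data.List.Membership.Propositional using (_∈_)
open import Data.List.Membership.Propositional.Properties using (∈-allFin; ∈-map⁺; ∈-++⁺ˡ; ∈-++⁺ʳ)
open import Data.List.Properties using (map-++; map-∘; map-cong; ++-identityʳ)
open import Data.List.Relation.Unary.All as All using ()
open import Data.List.Relation.Unary.All.Properties using (all⁺; all⁻)
open import Data.List.Relation.Unary.Any using (satisfied)
open import Data.List.Relation.Unary.Any.Properties using (any⁻)
open import Data.Nat as ℕ using (ℕ; zero; suc; _+_; _∸_; _%_; _<ᵇ_; _≡ᵇ_)
open import Data.Nat.DivMod using (m<n⇒m%n≡m; %-distribˡ-+; [m+n]%n≡m%n)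
open import Data.Nat.ListAction using (sum)
open import Data.Nat.ListAction.Properties using (sum-++)
import Data.Nat.Properties as ℕ
open import Algebra.Properties.CommutativeSemigroup ℕ.+-commutativeSemigroup using (x∙yz≈y∙xz; interchange)
open import Data.Product using (_×_; _,_; proj₁; proj₂)
open import Data.Product.Function.NonDependent.Propositional using (_×-⇔_)
open import Data.Product.Relation.Binary.Lex.Strict using (×-strictTotalOrder)
open import Data.Sum using (inj₁; inj₂; [_,_]′)
open import Data.Sum.Function.Propositional using (_⊎-⇔_)
open import Data.Unit using (tt)
open import Data.Vec using (Vec; []; _∷_; lookup; tabulate)
open import Data.Vec.Properties
  using (∷-injectiveˡ; ∷-injectiveʳ; lookup∘tabulate; tabulate∘lookup; tabulate-cong)
open import Function using (_∘_; id)
open import Function.Bundles using (_⇔_; mk⇔; Equivalence)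
open import Function.Construct.Composition using (_⇔-∘_)
open import Function.Construct.Identity using (⇔-id)
open import Function.Construct.Symmetry using (⇔-sym)
open import Relation.Binary.Bundles using (StrictTotalOrder)
open import Relation.Binary.Definitions using (tri<; tri≈; tri>)
open import Relation.Binary.PropositionalEquality
  using (_≡_; _≢_; refl; sym; trans; cong; cong₂; subst; module ≡-Reasoning)
import Relation.Binary.Properties.StrictTotalOrder as StrictTotalOrderProperties
open import Relation.Nullary using (¬_; contradiction; yes; no)

open Equivalence using (to; from)

T-injective : ∀ {x y} → (T x ⇔ T y) → x ≡ y
T-injective {false} {false} _ = refl
T-injective {false} {true} x⇔y = contradiction (from x⇔y tt) id
T-injective {true} {false} x⇔y = contradiction (to x⇔y tt) id
T-injective {true} {true} _ = refl

¬T⇔≡false : ∀ {x} → (¬ T x) ⇔ (x ≡ false)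
¬T⇔≡false {false} = mk⇔ (λ _ → refl) (λ _ ())
¬T⇔≡false {true} = mk⇔ (λ ¬t → contradiction tt ¬t) (λ ())

T-∧-assoc : ∀ x y z → T (x ∧ y ∧ z) ⇔ (T (x ∧ y) × T z)
T-∧-assoc true y z = T-∧
T-∧-assoc false y z = mk⇔ (λ ()) (λ ())

T-not-∨ : ∀ x y → T (not x ∨ y) ⇔ (T x → T y)
T-not-∨ false y = mk⇔ (λ _ ()) _
T-not-∨ true y = mk⇔ (λ t _ → t) (λ f → f _)

T-∧-implication : ∀ a b c d → T (a ∧ (not (b ∧ c) ∨ d)) ⇔ (T a × (T b → T c → T d))
T-∧-implication false b c d = mk⇔ (λ ()) proj₁
T-∧-implication true false c d = mk⇔ (λ _ → _ , λ ()) _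
T-∧-implication true true false d = mk⇔ (λ _ → _ , λ _ ()) _
T-∧-implication true true true d = mk⇔ (λ t → _ , λ _ _ → t) (λ (_ , f) → f _ _)

T-not⇒T⇔ : ∀ x y → (T (not x) → T y) ⇔ (y ≡ false → T x)
T-not⇒T⇔ true y = mk⇔ (λ _ _ → tt) (λ _ ())
T-not⇒T⇔ false true = mk⇔ (λ _ ()) (λ _ _ → tt)
T-not⇒T⇔ false false = mk⇔ (λ h _ → h tt) (λ h _ → h refl)

T-<ᵇ : ∀ {k} {c d : Fin k} → T (toℕ c <ᵇ toℕ d) ⇔ c Fin.< d
T-<ᵇ = mk⇔ (ℕ.<ᵇ⇒< _ _) ℕ.<⇒<ᵇ

T-≡ᵇ : ∀ {k} {c d : Fin k} → T (toℕ c ≡ᵇ toℕ d) ⇔ c ≡ d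
T-≡ᵇ = mk⇔ (toℕ-injective ∘ ℕ.≡ᵇ⇒≡ _ _) (ℕ.≡⇒≡ᵇ _ _ ∘ cong toℕ)

module _ {A : Set} {xs : List A} (complete : ∀ a → a ∈ xs) where

  T-all : (p : A → Bool) → T (all p xs) ⇔ (∀ a → T (p a))
  T-all p = mk⇔ (λ h a → All.lookup (all⁺ p xs h) (complete a))
                (λ h → all⁻ p {xs} (All.tabulate (λ {a} _ → h a)))

  T-all-implies : (R E : A → A → Bool) →
    T (all (λ a → all (λ b → not (R a b) ∨ E a b) xs) xs) ⇔ (∀ a b → T (R a b) → T (E a b))
  T-all-implies R E = mk⇔
    (λ h a b → to (T-not-∨ (R a b) (E a b)) (to (T-all _) (to (T-all _) h a) b))
    (λ h → from (T-all _) λ a → from (T-all _) λ b → from (T-not-∨ _ _) (h a b))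

lexOrder : (R m : ℕ) → StrictTotalOrder _ _ _
lexOrder R m = ×-strictTotalOrder (<-strictTotalOrder R) (<-strictTotalOrder m)

module Lex (R m : ℕ) where
  open StrictTotalOrder (lexOrder R m) public
  open StrictTotalOrderProperties (lexOrder R m) public using (_≤_)

  T-lexLt : (p q : Fin R × Fin m) → T (lexLt p q) ⇔ p < q
  T-lexLt (a , x) (b , y) = (T-<ᵇ ⊎-⇔ ((T-≡ᵇ ×-⇔ T-<ᵇ) ⇔-∘ T-∧)) ⇔-∘ T-∨

  T-lexEq : (p q : Fin R × Fin m) → T (lexEq p q) ⇔ p ≈ q
  T-lexEq (a , x) (b , y) = (T-≡ᵇ ×-⇔ T-≡ᵇ) ⇔-∘ T-∧

  T-lexLe : (p q : Fin R × Fin m) → T (lexLe p q) ⇔ p ≤ q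
  T-lexLe p q = (T-lexLt p q ⊎-⇔ T-lexEq p q) ⇔-∘ T-∨

  ≤⇒≯ : ∀ {p q} → p ≤ q → ¬ (q < p)
  ≤⇒≯ (inj₁ p<q) q<p = asym p<q q<p
  ≤⇒≯ (inj₂ p≈q) q<p = irrefl (Eq.sym p≈q) q<p

  ≯⇒≤ : ∀ {p q} → ¬ (q < p) → p ≤ q
  ≯⇒≤ {p} {q} q≮p with compare p q
  ... | tri< p<q _ _ = inj₁ p<q
  ... | tri≈ _ p≈q _ = inj₂ p≈q
  ... | tri> _ _ q<p = contradiction q<p q≮p

recolour : ∀ {r l} → Fin (suc r) → Fin (suc r) × Fin l → Fin (suc r) × Fin l
recolour k p = proj₁ p ⊖ k , proj₂ p

-- Conditions (ii) and (iii) for a ≺ b, with u = f(a), v = f(b) and la, lb the labels (ε , |·|) of a, b.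
edge : ∀ {r m l} → Fin (suc r) × Fin m → Fin (suc r) × Fin m →
       Fin (suc r) × Fin l → Fin (suc r) × Fin l → Bool
edge u v la lb =
  lexLe u v ∧ (not ((toℕ (proj₁ u) == toℕ (proj₁ v))
                    ∧ lexLt (recolour (proj₁ u) lb) (recolour (proj₁ u) la))
               ∨ lexLt u v)

module _ {r m l : ℕ} where
  private
    module V = Lex (suc r) m
    module L = Lex (suc r) l

  keyOrder : StrictTotalOrder _ _ _
  keyOrder = ×-strictTotalOrder (lexOrder (suc r) m) (lexOrder (suc r) l)

  open StrictTotalOrderProperties keyOrder
    using () renaming (_≤_ to _≤ₖ_; trans to ≤ₖ-trans; antisym to ≤ₖ-antisym; total to ≤ₖ-total)

  key : Fin (suc r) × Fin m → Fin (suc r) × Fin l → (Fin (suc r) × Fin m) × (Fin (suc r) × Fin l)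
  key u la = u , recolour (proj₁ u) la

  EdgeCondition : (u v : Fin (suc r) × Fin m) (la lb : Fin (suc r) × Fin l) → Set
  EdgeCondition u v la lb =
    u V.≤ v × (proj₁ u ≡ proj₁ v → recolour (proj₁ u) lb L.< recolour (proj₁ u) la → u V.< v)

  T-edge : ∀ u v la lb → T (edge u v la lb) ⇔ EdgeCondition u v la lb
  T-edge u v la lb = mk⇔
    (λ h → let u≤v , strict = to (T-∧-implication _ _ _ _) h in
           to (V.T-lexLe u v) u≤v ,
           λ same lb<la → to (V.T-lexLt u v) (strict (from T-≡ᵇ same) (from (L.T-lexLt _ _) lb<la)))
    (λ (u≤v , strict) → from (T-∧-implication _ _ _ _)
           (from (V.T-lexLe u v) u≤v ,
            λ same lb<la → from (V.T-lexLt u v) (strict (to T-≡ᵇ same) (to (L.T-lexLt _ _) lb<la))))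

  ≤ₖ⇒proj₁≤ : ∀ {k k'} → k ≤ₖ k' → proj₁ k V.≤ proj₁ k'
  ≤ₖ⇒proj₁≤ (inj₁ (inj₁ lt)) = inj₁ lt
  ≤ₖ⇒proj₁≤ (inj₁ (inj₂ (eq , _))) = inj₂ eq
  ≤ₖ⇒proj₁≤ (inj₂ (eq , _)) = inj₂ eq

  ≤ₖ⇔proj₂≤ : ∀ {u a b} → (u , a) ≤ₖ (u , b) ⇔ a L.≤ b
  ≤ₖ⇔proj₂≤ = mk⇔
    (λ { (inj₁ (inj₁ lt)) → contradiction lt (V.irrefl V.Eq.refl)
       ; (inj₁ (inj₂ (_ , lt))) → inj₁ lt
       ; (inj₂ (_ , eq)) → inj₂ eq })
    (λ { (inj₁ lt) → inj₁ (inj₂ (V.Eq.refl , lt))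
       ; (inj₂ eq) → inj₂ (V.Eq.refl , eq) })

  EdgeCondition⇔key≤ : ∀ u v la lb → EdgeCondition u v la lb ⇔ key u la ≤ₖ key v lb
  EdgeCondition⇔key≤ (c , x) (c' , x') la lb with V.compare (c , x) (c' , x')
  ... | tri< u<v _ _ = mk⇔ (λ _ → inj₁ (inj₁ u<v)) (λ _ → inj₁ u<v , λ _ _ → u<v)
  ... | tri> _ _ v<u = mk⇔ (λ (u≤v , _) → contradiction v<u (V.≤⇒≯ u≤v))
                           (λ k≤k' → contradiction v<u (V.≤⇒≯ (≤ₖ⇒proj₁≤ k≤k')))
  ... | tri≈ _ (refl , refl) _ = mk⇔
    (λ (_ , strict) → from ≤ₖ⇔proj₂≤ (L.≯⇒≤ (λ lt → V.irrefl V.Eq.refl (strict refl lt))))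
    (λ k≤k' → inj₂ V.Eq.refl , λ _ lt → contradiction lt (L.≤⇒≯ (to ≤ₖ⇔proj₂≤ k≤k')))

  T-edge⇔key≤ : ∀ u v la lb → T (edge u v la lb) ⇔ key u la ≤ₖ key v lb
  T-edge⇔key≤ u v la lb = EdgeCondition⇔key≤ u v la lb ⇔-∘ T-edge u v la lb

  edge-trans : ∀ {u v w la lb lc} → T (edge u v la lb) → T (edge v w lb lc) → T (edge u w la lc)
  edge-trans {u} {v} {w} {la} {lb} {lc} uv vw = from (T-edge⇔key≤ u w la lc)
    (≤ₖ-trans (to (T-edge⇔key≤ u v la lb) uv) (to (T-edge⇔key≤ v w lb lc) vw))

  edge-flip : ∀ u v la lb → proj₂ la ≢ proj₂ lb → T (edge v u lb la) ⇔ (¬ T (edge u v la lb))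
  edge-flip u v la lb la≢lb = mk⇔
    (λ vu uv → la≢lb (proj₂ (proj₂
      (≤ₖ-antisym (to (T-edge⇔key≤ u v la lb) uv) (to (T-edge⇔key≤ v u lb la) vu)))))
    (λ ¬uv → from (T-edge⇔key≤ v u lb la)
               ([ (λ uv → contradiction (from (T-edge⇔key≤ u v la lb) uv) ¬uv) , id ]′
                (≤ₖ-total (key u la) (key v lb))))

⊕-⊖-cancel : ∀ {r} (c c' : Fin (suc r)) → c ⊕ (c' ⊖ c) ≡ c'
⊕-⊖-cancel {r} c c' = toℕ-injective (begin
  toℕ (c ⊕ (c' ⊖ c))                 ≡⟨ toℕ-fromℕ< _ ⟩
  (a + toℕ (c' ⊖ c)) % R              ≡⟨ cong (λ x → (a + x) % R) (toℕ-fromℕ< _) ⟩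
  (a + (b + (R ∸ a)) % R) % R         ≡⟨ cong (λ x → (x + (b + (R ∸ a)) % R) % R) (m<n⇒m%n≡m (toℕ<n c)) ⟨
  (a % R + (b + (R ∸ a)) % R) % R     ≡⟨ %-distribˡ-+ a _ R ⟨
  (a + (b + (R ∸ a))) % R             ≡⟨ cong (_% R) (x∙yz≈y∙xz a b (R ∸ a)) ⟩
  (b + (a + (R ∸ a))) % R             ≡⟨ cong (λ x → (b + x) % R) (ℕ.m+[n∸m]≡n (ℕ.<⇒≤ (toℕ<n c))) ⟩
  (b + R) % R                         ≡⟨ [m+n]%n≡m%n b R ⟩
  b % R                               ≡⟨ m<n⇒m%n≡m (toℕ<n c') ⟩
  b                                   ∎)
  where
  open ≡-Reasoning
  R = suc r
  a = toℕ c
  b = toℕ c'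

-- Equivariance recolours π(i) into the colour of π(i'); injectivity of π then identifies i and i'.
absoluteValue-injective : ∀ {r n} (π : G (suc r) n) {i i'} →
  proj₂ (πat π i) ≡ proj₂ (πat π i') → i ≡ i'
absoluteValue-injective π {i} {i'} same = cong proj₂ (proj₁ (bij π) (begin
  fun π (fzero ⊕ (c' ⊖ c) , i)    ≡⟨ equivariant π i fzero _ _ (c' ⊖ c) refl ⟩
  c ⊕ (c' ⊖ c) , proj₂ (πat π i)  ≡⟨ cong₂ _,_ (⊕-⊖-cancel c c') same ⟩
  πat π i'                        ∎))
  where
  open ≡-Reasoning
  c = proj₁ (πat π i)
  c' = proj₁ (πat π i')

-- 0_1; the split is needed because nZeros (suc r) is not a successor when r is a variable.
firstZero : ∀ {r} → Fin (nZeros (suc r))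
firstZero {zero} = fzero
firstZero {suc r} = fzero

toℕ-firstZero : ∀ {r} → toℕ (firstZero {r}) ≡ 0
toℕ-firstZero {zero} = refl
toℕ-firstZero {suc r} = refl

next : ∀ {r n} → Fin n → Elt (suc r) n
next {n = n} i with suc (toℕ i) ℕ.<? n
... | yes i+1<n = inj₁ (Fin.fromℕ< i+1<n)
... | no _ = inj₂ firstZero

-- The adjacency test hidden in genZ and genC.
isNext : ∀ {r n} → Fin n → Elt r n → Bool
isNext i (inj₁ i') = toℕ i' == suc (toℕ i)
isNext i (inj₂ m) = isZeroIdx m ∧ isLast i

T-isNext : ∀ {r n} (i : Fin n) (b : Elt (suc r) n) → T (isNext i b) ⇔ b ≡ next i
T-isNext {n = n} i b with suc (toℕ i) ℕ.<? n
T-isNext i (inj₁ i') | yes i+1<n = mk⇔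
  (λ h → cong inj₁ (toℕ-injective (trans (ℕ.≡ᵇ⇒≡ _ _ h) (sym (toℕ-fromℕ< i+1<n)))))
  (λ { refl → ℕ.≡⇒≡ᵇ _ _ (toℕ-fromℕ< i+1<n) })
T-isNext i (inj₁ i') | no i+1≮n = mk⇔
  (λ h → contradiction (subst (ℕ._< _) (ℕ.≡ᵇ⇒≡ _ _ h) (toℕ<n i')) i+1≮n)
  (λ ())
T-isNext i (inj₂ m) | yes i+1<n = mk⇔
  (λ h → contradiction i+1<n (ℕ.<-irrefl (ℕ.≡ᵇ⇒≡ _ _ (proj₂ (to T-∧ h)))))
  (λ ())
T-isNext {r} {n} i (inj₂ m) | no i+1≮n = mk⇔
  (λ h → cong inj₂ (toℕ-injective (trans (ℕ.≡ᵇ⇒≡ _ _ (proj₁ (to T-∧ h))) (sym toℕ-firstZero))))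
  (λ { refl → from T-∧ (ℕ.≡⇒≡ᵇ _ _ (toℕ-firstZero {r}) ,
                        ℕ.≡⇒≡ᵇ _ _ (ℕ.≤-antisym (toℕ<n i) (ℕ.≮⇒≥ i+1≮n))) })

isNext-next : ∀ {r n} (i : Fin n) → T (isNext i (next {r} i))
isNext-next i = from (T-isNext i (next i)) refl

consecutive-absoluteValues-distinct : ∀ {r n} (π : G (suc r) n) (i : Fin n) →
  proj₂ (label π (inj₁ i)) ≢ proj₂ (label π (next {r} i))
consecutive-absoluteValues-distinct π i = distinct (next i) (isNext-next i)
  where
  distinct : ∀ b → T (isNext i b) → proj₂ (label π (inj₁ i)) ≢ proj₂ (label π b)
  distinct (inj₁ i') i'≡i+1 same with absoluteValue-injective π (suc-injective same)
  ... | refl = ℕ.1+n≢n (sym (ℕ.≡ᵇ⇒≡ (toℕ i) (suc (toℕ i)) i'≡i+1))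
  distinct (inj₂ m) _ ()

module _ {r n : ℕ} (I : Subset n) where

  data ZGenerator : Elt (suc r) n → Elt (suc r) n → Set where
    ascent    : ∀ {i} → lookup I i ≡ false → ZGenerator (inj₁ i) (next i)
    descent   : ∀ {i} → lookup I i ≡ true → ZGenerator (next i) (inj₁ i)
    zeroChain : ∀ {m m'} → T (genZeros m m') → ZGenerator (inj₂ m) (inj₂ m')

  data CGenerator : Elt (suc r) n → Elt (suc r) n → Set where
    ascent    : ∀ {i} → lookup I i ≡ false → CGenerator (inj₁ i) (next i)
    zeroChain : ∀ {m m'} → T (genZeros m m') → CGenerator (inj₂ m) (inj₂ m')

  private
    genZ-ascent : ∀ i b → T (isNext i b) → lookup I i ≡ false → T (genZ {suc r} I (inj₁ i) b)
    genZ-ascent i (inj₁ i') h i∉I rewrite i∉I = from T-∨ (inj₁ (from T-∧ (h , tt)))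
    genZ-ascent i (inj₂ m) h i∉I rewrite i∉I = from (T-∧-assoc (isZeroIdx m) (isLast i) _) (h , tt)

    genZ-descent : ∀ i b → T (isNext i b) → lookup I i ≡ true → T (genZ {suc r} I b (inj₁ i))
    genZ-descent i (inj₁ i') h i∈I rewrite i∈I = from T-∨ (inj₂ (from T-∧ (h , tt)))
    genZ-descent i (inj₂ m) h i∈I rewrite i∈I = from (T-∧-assoc (isZeroIdx m) (isLast i) _) (h , tt)

    genC-ascent : ∀ i b → T (isNext i b) → lookup I i ≡ false → T (genC {suc r} I (inj₁ i) b)
    genC-ascent i (inj₁ i') h i∉I rewrite i∉I = from T-∧ (h , tt)
    genC-ascent i (inj₂ m) h i∉I rewrite i∉I = from (T-∧-assoc (isZeroIdx m) (isLast i) _) (h , tt)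

    ascentTo : (G : Elt (suc r) n → Elt (suc r) n → Set) → ∀ {i b} →
               (lookup I i ≡ false → G (inj₁ i) (next i)) →
               T (isNext i b) → T (not (lookup I i)) → G (inj₁ i) b
    ascentTo G {i} {b} gen adj i∉I = subst (G (inj₁ i)) (sym (to (T-isNext i b) adj)) (gen (to T-not-≡ i∉I))

  T-genZ : ∀ a b → T (genZ {suc r} I a b) ⇔ ZGenerator a b
  T-genZ a b = mk⇔ (genZ⇒ a b) ⇒genZ
    where
    genZ⇒ : ∀ a b → T (genZ {suc r} I a b) → ZGenerator a b
    genZ⇒ (inj₁ i) (inj₁ i') h with to T-∨ h
    ... | inj₁ up = let adj , i∉I = to T-∧ up in ascentTo ZGenerator ascent adj i∉I
    ... | inj₂ down = let adj , i'∈I = to T-∧ down in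
                      subst (λ a → ZGenerator a (inj₁ i')) (sym (to (T-isNext i' _) adj))
                            (descent (to T-≡ i'∈I))
    genZ⇒ (inj₁ i) (inj₂ m) h = let adj , i∉I = to (T-∧-assoc (isZeroIdx m) (isLast i) _) h in
      ascentTo ZGenerator ascent adj i∉I
    genZ⇒ (inj₂ m) (inj₁ i) h = let adj , i∈I = to (T-∧-assoc (isZeroIdx m) (isLast i) _) h in
      subst (λ a → ZGenerator a (inj₁ i)) (sym (to (T-isNext i _) adj)) (descent (to T-≡ i∈I))
    genZ⇒ (inj₂ m) (inj₂ m') h = zeroChain h
    ⇒genZ : ∀ {a b} → ZGenerator a b → T (genZ {suc r} I a b)
    ⇒genZ (ascent {i} i∉I) = genZ-ascent i (next i) (isNext-next i) i∉I
    ⇒genZ (descent {i} i∈I) = genZ-descent i (next i) (isNext-next i) i∈I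
    ⇒genZ (zeroChain h) = h

  T-genC : ∀ a b → T (genC {suc r} I a b) ⇔ CGenerator a b
  T-genC a b = mk⇔ (genC⇒ a b) ⇒genC
    where
    genC⇒ : ∀ a b → T (genC {suc r} I a b) → CGenerator a b
    genC⇒ (inj₁ i) (inj₁ i') h = let adj , i∉I = to T-∧ h in ascentTo CGenerator ascent adj i∉I
    genC⇒ (inj₁ i) (inj₂ m) h = let adj , i∉I = to (T-∧-assoc (isZeroIdx m) (isLast i) _) h in
      ascentTo CGenerator ascent adj i∉I
    genC⇒ (inj₂ m) (inj₂ m') h = zeroChain h
    ⇒genC : ∀ {a b} → CGenerator a b → T (genC {suc r} I a b)
    ⇒genC (ascent {i} i∉I) = genC-ascent i (next i) (isNext-next i) i∉I
    ⇒genC (zeroChain h) = h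

module _ {A : Set} (xs : List A) {R E : A → A → Bool}
         (E-trans : ∀ {a b c} → T (E a b) → T (E b c) → T (E a c)) where

  reach-respects : (∀ a b → T (R a b) → T (E a b)) → ∀ t a b → T (reach xs R t a b) → T (E a b)
  reach-respects R⊆E zero a b h = R⊆E a b h
  reach-respects R⊆E (suc t) a b h with to T-∨ h
  ... | inj₁ a↝b = reach-respects R⊆E t a b a↝b
  ... | inj₂ a↝·R·b with satisfied (any⁻ _ xs a↝·R·b)
  ...   | c , a↝c∧Rcb = let a↝c , Rcb = to T-∧ a↝c∧Rcb in
                        E-trans (reach-respects R⊆E t a c a↝c) (R⊆E c b Rcb)

  ⊆reach : ∀ t a b → T (R a b) → T (reach xs R t a b)
  ⊆reach zero a b h = h
  ⊆reach (suc t) a b h = from T-∨ (inj₁ (⊆reach t a b h))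

  T-reach-respects : ∀ t →
    (∀ a b → T (reach xs R t a b) → T (E a b)) ⇔ (∀ a b → T (R a b) → T (E a b))
  T-reach-respects t = mk⇔ (λ h a b → h a b ∘ ⊆reach t a b) (λ h → reach-respects h t)

∈-allElts : ∀ {r n} (a : Elt r n) → a ∈ allElts r n
∈-allElts (inj₁ i) = ∈-++⁺ˡ (∈-map⁺ inj₁ (∈-allFin i))
∈-allElts {n = n} (inj₂ m) = ∈-++⁺ʳ (map inj₁ (allFin n)) (∈-map⁺ inj₂ (∈-allFin m))

module _ {r n : ℕ} (π : G (suc r) n) {j : ℕ} (f : Map (suc r) n j) where

  edgeAt : Elt (suc r) n → Elt (suc r) n → Bool
  edgeAt a b = edge (app f a) (app f b) (label π a) (label π b)

  ascentAt : Fin n → Bool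
  ascentAt i = edgeAt (inj₁ i) (next i)

  descentAt-flip : ∀ i → T (edgeAt (next i) (inj₁ i)) ⇔ (¬ T (ascentAt i))
  descentAt-flip i = edge-flip (app f (inj₁ i)) (app f (next i)) (label π (inj₁ i)) (label π (next i))
                               (consecutive-absoluteValues-distinct π i)

  ZeroChainRespected : Set
  ZeroChainRespected = ∀ m m' → T (genZeros m m') → T (edgeAt (inj₂ m) (inj₂ m'))

  respects-genZ : ∀ I → (∀ a b → T (genZ {suc r} I a b) → T (edgeAt a b)) ⇔
                        (ZeroChainRespected × (∀ i → lookup I i ≡ not (ascentAt i)))
  respects-genZ I = mk⇔
    (λ h → let respects = λ {a b} → h a b ∘ from (T-genZ I a b) in
           (λ m m' → respects ∘ zeroChain) , orientation respects)
    (λ (zeros , orient) a b → edge-of orient zeros ∘ to (T-genZ I a b))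
    where
    orientation : (∀ {a b} → ZGenerator I a b → T (edgeAt a b)) → ∀ i → lookup I i ≡ not (ascentAt i)
    orientation h i with lookup I i in i∈I
    ... | true = sym (cong not (to ¬T⇔≡false (to (descentAt-flip i) (h (descent i∈I)))))
    ... | false = sym (cong not (to T-≡ (h (ascent i∈I))))
    edge-of : (∀ i → lookup I i ≡ not (ascentAt i)) → ZeroChainRespected →
              ∀ {a b} → ZGenerator I a b → T (edgeAt a b)
    edge-of orient _ (ascent {i} i∉I) = from T-≡ (not-injective (trans (sym (orient i)) i∉I))
    edge-of orient _ (descent {i} i∈I) =
      from (descentAt-flip i) (from ¬T⇔≡false (not-injective (trans (sym (orient i)) i∈I)))
    edge-of _ zeros (zeroChain g) = zeros _ _ g

  respects-genC : ∀ I → (∀ a b → T (genC {suc r} I a b) → T (edgeAt a b)) ⇔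
                        (ZeroChainRespected × (∀ i → lookup I i ≡ false → T (ascentAt i)))
  respects-genC I = mk⇔
    (λ h → let respects = λ {a b} → h a b ∘ from (T-genC I a b) in
           (λ m m' → respects ∘ zeroChain) , λ i → respects ∘ ascent)
    (λ (zeros , ascents) a b → edge-of zeros ascents ∘ to (T-genC I a b))
    where
    edge-of : ZeroChainRespected → (∀ i → lookup I i ≡ false → T (ascentAt i)) →
              ∀ {a b} → CGenerator I a b → T (edgeAt a b)
    edge-of _ ascents (ascent i∉I) = ascents _ i∉I
    edge-of zeros _ (zeroChain g) = zeros _ _ g

  zerosPinned : Bool
  zerosPinned = all (λ m → lexEq (app f (inj₂ m)) (zeroColour m , fzero)) (allFin (nZeros (suc r)))

  topValuesColoured : Bool
  topValuesColoured =
    all (λ a → not (toℕ (proj₂ (app f a)) == j) ∨ (toℕ (proj₁ (app f a)) == toℕ (proj₁ (label π a))))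
        (allElts (suc r) n)

  SharedConditions : Set
  SharedConditions = T zerosPinned × ZeroChainRespected × T topValuesColoured

  T-isPPartition : ∀ R {L : Set} → (∀ a b → T (R a b) → T (edgeAt a b)) ⇔ (ZeroChainRespected × L) →
                   T (isPPartition π (order {suc r} R) j f) ⇔ (SharedConditions × L)
  T-isPPartition R respects⇔ = mk⇔
    (λ h → let pinned , respects , coloured = to split h
               zeros , local = to (respects⇔ ⇔-∘ respectsOrder⇔) respects
           in (pinned , zeros , coloured) , local)
    (λ ((pinned , zeros , coloured) , local) →
       from split (pinned , from (respects⇔ ⇔-∘ respectsOrder⇔) (zeros , local) , coloured))
    where
    els = allElts (suc r) n
    respectsOrder : Bool
    respectsOrder = all (λ a → all (λ b → not (order {suc r} R a b) ∨ edgeAt a b) els) els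
    split : T (isPPartition π (order {suc r} R) j f) ⇔ (T zerosPinned × T respectsOrder × T topValuesColoured)
    split = (⇔-id _ ×-⇔ T-∧ {respectsOrder}) ⇔-∘ T-∧ {zerosPinned}
    respectsOrder⇔ : T respectsOrder ⇔ (∀ a b → T (R a b) → T (edgeAt a b))
    respectsOrder⇔ =
      T-reach-respects els
        (λ {a b c} → edge-trans {u = app f a} {app f b} {app f c} {label π a} {label π b} {label π c})
        (n + nZeros (suc r))
      ⇔-∘ T-all-implies ∈-allElts (order {suc r} R) edgeAt

occupied : ∀ {n} → Bars n → Fin n → Bool
occupied b i = 0 << lookup b (fsuc i)

T-isBarredZ : ∀ {n} (I : Subset n) (b : Bars n) →
  T (isBarredZ I b) ⇔ (∀ i → T (lookup I i) → T (occupied b i))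
T-isBarredZ I b = mk⇔
  (λ h i → to (T-not-∨ _ _) (to (T-all ∈-allFin _) h i))
  (λ h → from (T-all ∈-allFin _) λ i → from (T-not-∨ _ _) (h i))

T-isBarredC : ∀ {n} (I : Subset n) (b : Bars n) →
  T (isBarredC I b) ⇔ (∀ i → lookup I i ≡ occupied b i)
T-isBarredC I b = mk⇔
  (λ h i → to (T-ifOccupied (lookup I i) (lookup b (fsuc i))) (to (T-all ∈-allFin _) h i))
  (λ h → from (T-all ∈-allFin _) λ i → from (T-ifOccupied _ (lookup b (fsuc i))) (h i))
  where
  T-ifOccupied : ∀ x k → T (if x then 0 << k else k == 0) ⇔ (x ≡ (0 << k))
  T-ifOccupied true zero = mk⇔ (λ ()) (λ ())
  T-ifOccupied true (suc k) = mk⇔ (λ _ → refl) _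
  T-ifOccupied false zero = mk⇔ (λ _ → refl) _
  T-ifOccupied false (suc k) = mk⇔ (λ ()) (λ ())

indicator : Bool → ℕ
indicator b = if b then 1 else 0

indicator-vanishes : ∀ {x} → ¬ T x → indicator x ≡ 0
indicator-vanishes = cong indicator ∘ to ¬T⇔≡false

count≡sum-indicator : ∀ {A : Set} (p : A → Bool) xs → count p xs ≡ sum (map (indicator ∘ p) xs)
count≡sum-indicator p [] = refl
count≡sum-indicator p (x ∷ xs) with p x
... | true = cong suc (count≡sum-indicator p xs)
... | false = count≡sum-indicator p xs

sum-map-+ : ∀ {A : Set} (f g : A → ℕ) xs → sum (map (λ x → f x + g x) xs) ≡ sum (map f xs) + sum (map g xs)
sum-map-+ f g [] = refl
sum-map-+ f g (x ∷ xs) =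
  trans (cong (f x + g x +_) (sum-map-+ f g xs)) (interchange (f x) (g x) (sum (map f xs)) (sum (map g xs)))

sum-map-const-0 : ∀ {A : Set} (xs : List A) → sum (map (λ _ → 0) xs) ≡ 0
sum-map-const-0 [] = refl
sum-map-const-0 (x ∷ xs) = sum-map-const-0 xs

sum-map-comm : ∀ {A B : Set} (g : A → B → ℕ) xs ys →
  sum (map (λ x → sum (map (g x) ys)) xs) ≡ sum (map (λ y → sum (map (λ x → g x y) xs)) ys)
sum-map-comm g [] ys = sym (sum-map-const-0 ys)
sum-map-comm g (x ∷ xs) ys =
  trans (cong (sum (map (g x) ys) +_) (sum-map-comm g xs ys)) (sym (sum-map-+ (g x) _ ys))

sum-count-comm : ∀ {A B : Set} (p : A → B → Bool) xs ys →
  sum (map (λ x → count (p x) ys) xs) ≡ sum (map (λ y → sum (map (λ x → indicator (p x y)) xs)) ys)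
sum-count-comm p xs ys =
  trans (cong sum (map-cong (λ x → count≡sum-indicator (p x) ys) xs))
        (sum-map-comm (λ x y → indicator (p x y)) xs ys)

ΣSubsets-suc : ∀ n (F : Subset (suc n) → ℕ) →
  ΣSubsets (suc n) F ≡ ΣSubsets n (F ∘ (false ∷_)) + ΣSubsets n (F ∘ (true ∷_))
ΣSubsets-suc n F = begin
  sum (map F (map (false ∷_) S ++ (map (true ∷_) S ++ [])))
    ≡⟨ cong (λ ys → sum (map F (map (false ∷_) S ++ ys))) (++-identityʳ _) ⟩
  sum (map F (map (false ∷_) S ++ map (true ∷_) S))
    ≡⟨ cong sum (map-++ F (map (false ∷_) S) _) ⟩
  sum (map F (map (false ∷_) S) ++ map F (map (true ∷_) S))
    ≡⟨ sum-++ (map F (map (false ∷_) S)) _ ⟩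
  sum (map F (map (false ∷_) S)) + sum (map F (map (true ∷_) S))
    ≡⟨ cong₂ _+_ (cong sum (map-∘ S)) (cong sum (map-∘ S)) ⟨
  ΣSubsets n (F ∘ (false ∷_)) + ΣSubsets n (F ∘ (true ∷_)) ∎
  where
  open ≡-Reasoning
  S = allSubsets n

ΣSubsets-indicator-unique : ∀ n (q : Subset n → Bool) (v : Subset n) →
  (∀ I → T (q I) → I ≡ v) → ΣSubsets n (indicator ∘ q) ≡ indicator (q v)
ΣSubsets-indicator-unique zero q [] _ = ℕ.+-identityʳ _
ΣSubsets-indicator-unique (suc n) q (c ∷ v) unique = begin
  ΣSubsets (suc n) (indicator ∘ q)
    ≡⟨ ΣSubsets-suc n _ ⟩
  ΣSubsets n (indicator ∘ q ∘ (false ∷_)) + ΣSubsets n (indicator ∘ q ∘ (true ∷_))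
    ≡⟨ cong₂ _+_ (tail false) (tail true) ⟩
  indicator (q (false ∷ v)) + indicator (q (true ∷ v))
    ≡⟨ head c (λ b → ∷-injectiveˡ ∘ unique (b ∷ v)) ⟩
  indicator (q (c ∷ v)) ∎
  where
  open ≡-Reasoning
  tail : ∀ b → ΣSubsets n (indicator ∘ q ∘ (b ∷_)) ≡ indicator (q (b ∷ v))
  tail b = ΣSubsets-indicator-unique n (q ∘ (b ∷_)) v (λ I → ∷-injectiveʳ ∘ unique (b ∷ I))
  head : ∀ c → (∀ b → T (q (b ∷ v)) → b ≡ c) →
         indicator (q (false ∷ v)) + indicator (q (true ∷ v)) ≡ indicator (q (c ∷ v))
  head false only =
    trans (cong (indicator (q (false ∷ v)) +_) (indicator-vanishes ((λ ()) ∘ only true))) (ℕ.+-identityʳ _)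
  head true only = cong (_+ indicator (q (true ∷ v))) (indicator-vanishes ((λ ()) ∘ only false))

≡tabulate : ∀ {n} {A : Set} (v : Vec A n) {g : Fin n → A} → (∀ i → lookup v i ≡ g i) → v ≡ tabulate g
≡tabulate v eq = trans (sym (tabulate∘lookup v)) (tabulate-cong eq)

module _ {r n : ℕ} (π : G (suc r) n) {j : ℕ} (f : Map (suc r) n j) (b : Bars n) where

  countedZ : Subset n → Bool
  countedZ I = isPPartition π (order {suc r} (genZ {suc r} I)) j f ∧ isBarredZ I b

  countedC : Subset n → Bool
  countedC I = isPPartition π (order {suc r} (genC {suc r} I)) j f ∧ isBarredC I b

  descents : Subset n
  descents = tabulate (not ∘ ascentAt π f)

  barred : Subset n
  barred = tabulate (occupied b)

  T-countedZ : ∀ I → T (countedZ I) ⇔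
    ((SharedConditions π f × (∀ i → lookup I i ≡ not (ascentAt π f i))) ×
     (∀ i → T (lookup I i) → T (occupied b i)))
  T-countedZ I = (T-isPPartition π f _ (respects-genZ π f I) ×-⇔ T-isBarredZ I b)
                 ⇔-∘ T-∧ {isPPartition π (order {suc r} (genZ {suc r} I)) j f}

  T-countedC : ∀ I → T (countedC I) ⇔
    ((SharedConditions π f × (∀ i → lookup I i ≡ false → T (ascentAt π f i))) ×
     (∀ i → lookup I i ≡ occupied b i))
  T-countedC I = (T-isPPartition π f _ (respects-genC π f I) ×-⇔ T-isBarredC I b)
                 ⇔-∘ T-∧ {isPPartition π (order {suc r} (genC {suc r} I)) j f}

  countedZ-unique : ∀ I → T (countedZ I) → I ≡ descents
  countedZ-unique I = ≡tabulate I ∘ proj₂ ∘ proj₁ ∘ to (T-countedZ I)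

  countedC-unique : ∀ I → T (countedC I) → I ≡ barred
  countedC-unique I = ≡tabulate I ∘ proj₂ ∘ to (T-countedC I)

  T-countedZ-descents : T (countedZ descents) ⇔
    (SharedConditions π f × (∀ i → T (not (ascentAt π f i)) → T (occupied b i)))
  T-countedZ-descents = mk⇔
    (λ ((shared , _) , bars) → shared , λ i → bars i ∘ subst T (sym (lookup-descents i)))
    (λ (shared , bars) → (shared , lookup-descents) , λ i → bars i ∘ subst T (lookup-descents i))
    ⇔-∘ T-countedZ descents
    where lookup-descents = lookup∘tabulate (not ∘ ascentAt π f)

  T-countedC-barred : T (countedC barred) ⇔
    (SharedConditions π f × (∀ i → occupied b i ≡ false → T (ascentAt π f i)))
  T-countedC-barred = mk⇔
    (λ ((shared , ascents) , _) → shared , λ i → ascents i ∘ trans (lookup-barred i))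
    (λ (shared , ascents) → (shared , λ i → ascents i ∘ trans (sym (lookup-barred i))) , lookup-barred)
    ⇔-∘ T-countedC barred
    where lookup-barred = lookup∘tabulate (occupied b)

  T-countedZ⇔T-countedC : T (countedZ descents) ⇔ T (countedC barred)
  T-countedZ⇔T-countedC = ⇔-sym T-countedC-barred ⇔-∘ (contrapose ⇔-∘ T-countedZ-descents)
    where
    contrapose = mk⇔
      (λ (shared , bars) → shared , λ i → to (T-not⇒T⇔ (ascentAt π f i) (occupied b i)) (bars i))
      (λ (shared , ascents) → shared , λ i → from (T-not⇒T⇔ (ascentAt π f i) (occupied b i)) (ascents i))

  ΣSubsets-countedZ≡ΣSubsets-countedC :
    ΣSubsets n (indicator ∘ countedZ) ≡ ΣSubsets n (indicator ∘ countedC)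
  ΣSubsets-countedZ≡ΣSubsets-countedC = begin
    ΣSubsets n (indicator ∘ countedZ)  ≡⟨ ΣSubsets-indicator-unique n countedZ descents countedZ-unique ⟩
    indicator (countedZ descents)      ≡⟨ cong indicator (T-injective T-countedZ⇔T-countedC) ⟩
    indicator (countedC barred)        ≡⟨ ΣSubsets-indicator-unique n countedC barred countedC-unique ⟨
    ΣSubsets n (indicator ∘ countedC)  ∎
    where open ≡-Reasoning

open import Data.Nat using (_≤_)

mainTheorem12 : (r n : ℕ) → 1 ≤ r → 1 ≤ n → (π : G r n) → (j k : ℕ) →
    ΣSubsets n (λ I → ΩZ π I j k) ≡ ΣSubsets n (λ I → ΩC π I j k)
mainTheorem12 zero n () _ π j k
mainTheorem12 (suc r) n _ _ π j k = begin
  ΣSubsets n (λ I → ΩZ π I j k)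
    ≡⟨ sum-count-comm (λ I (f , b) → countedZ π f b I) (allSubsets n) pairs ⟩
  sum (map (λ (f , b) → ΣSubsets n (indicator ∘ countedZ π f b)) pairs)
    ≡⟨ cong sum (map-cong (λ (f , b) → ΣSubsets-countedZ≡ΣSubsets-countedC π f b) pairs) ⟩
  sum (map (λ (f , b) → ΣSubsets n (indicator ∘ countedC π f b)) pairs)
    ≡⟨ sum-count-comm (λ I (f , b) → countedC π f b I) (allSubsets n) pairs ⟨
  ΣSubsets n (λ I → ΩC π I j k) ∎
  where
  open ≡-Reasoning
  pairs = cartesianProduct (allMaps (suc r) n j) (allBars n k)
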